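{- Fix a threshold parameter $\varphi \in (0,1]$ and an integer $k \ge 0$. There is an absolute constant $C>0$ such that for every initial graph $G^{(0)}$ and every finite sequence $S$ of edge insertions, the algorithm $\textsc{Lazy-Alg}(\varphi,k)$ (described in the context) satisfies $T(S) \le C\left(\frac{1}{\varphi}+k\right)|S|$; that is, its amortized update cost is $O\!\left(\frac{1}{\varphi}+k\right)$ per edge insertion.
   Context: Graphs are undirected on a fixed vertex set $V$. A dynamic (incremental) graph starts from an initial graph $G^{(0)}$ and at each time step one new edge is inserted. For a vertex $x$, $N(x)$ is its current neighborhood, $\deg_x=|N(x)|$, $\mathcal{B}_1(x)=N(x)\cup\{x\}$ and $\mathcal{B}_2(x)$ is the set of vertices at distance at most $2$ from $x$ in the current graph. Algorithm $\textsc{Lazy-Alg}(\varphi,k)$ (with $\varphi\ge 0$, integer $k\ge 0$): each vertex $x$ stores sets $\widetilde{\mathcal{B}}_1(x)$, $\widetilde{\mathcal{B}}_2(x)$ and counters $\delta_x$ ("red degree") and $\Delta_x$ ("black degree"). Initialization on $G^{(0)}$: for each $x$, $\delta_x=0$, $\Delta_x=\deg_x$, $\widetilde{\mathcal{B}}_1(x)=\mathcal{B}_1(x)$, $\widetilde{\mathcal{B}}_2(x)=\mathcal{B}_2(x)$. On insertion of edge $(u,v)$ (added to the graph), for $x=u$ and then $x=v$, letting $y$ be the other endpoint: (1) $\widetilde{\mathcal{B}}_1(x)\gets\widetilde{\mathcal{B}}_1(x)\cup\{y\}$; (2) $\widetilde{\mathcal{B}}_2(x)\gets\widetilde{\mathcal{B}}_2(x)\cup\widetilde{\mathcal{B}}_1(y)$;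 (3) $\delta_x\gets\delta_x+1$; (4) if $\delta_x\ge\varphi\Delta_x$, then set $\Delta_x\gets\Delta_x+\delta_x$, $\delta_x\gets 0$, and for every $z\in N(x)$ perform $\widetilde{\mathcal{B}}_2(z)\gets\widetilde{\mathcal{B}}_2(z)\cup\widetilde{\mathcal{B}}_1(x)$; otherwise select $k$ vertices $w_1,\dots,w_k\in N(x)$ uniformly at random and for each $i$ perform $\widetilde{\mathcal{B}}_2(w_i)\gets\widetilde{\mathcal{B}}_2(w_i)\cup\widetilde{\mathcal{B}}_1(x)$. Cost: $T(S)$ is the total number of set-union operations performed in steps (1), (2), (4) while processing the insertion sequence $S$. The algorithm has amortized cost $\hat c$ per edge insertion if $T(S)\le \hat c|S|$ for every sequence $S$.
   Formalization: The threshold parameter $\varphi$ ranges only over the rationals in (0,1]. -}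

module Defs where

open import Data.Bool using (Bool; true; false; if_then_else_; _∨_; _∧_)
open import Data.Nat as ℕ using (ℕ; zero; suc; _%_)
open import Data.Fin using (Fin; _≟_)
open import Data.Fin.Subset using (Subset; _∪_; ⁅_⁆; ∣_∣)
open import Data.List using (List; []; _∷_; filter; length; foldl; map)
open import Data.Bool.ListAction using (any)
open import Data.List.Base using (allFin)
open import Data.Vec as Vec using (Vec; tabulate)
open import Data.Maybe using (Maybe; just; nothing)
open import Data.Product using (_×_; _,_; proj₁; proj₂)
open import Data.Unit using (⊤)
open import Data.Integer using (+_)
open import Data.Rational as ℚ using (ℚ; _/_)
import Data.Rational.Properties as ℚP
open import Relation.Nullary using (¬_; does)
open import Relation.Binary.PropositionalEquality using (_≡_)

ℕ→ℚ : ℕ → ℚ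
ℕ→ℚ m = (+ m) / 1

Adj : ℕ → Set
Adj n = Fin n → Fin n → Bool

IsSimpleGraph : ∀ {n} → Adj n → Set
IsSimpleGraph {n} a = (∀ x y → a x y ≡ a y x) × (∀ x → a x x ≡ false)

addEdge : ∀ {n} → Adj n → Fin n → Fin n → Adj n
addEdge a u v x y =
  a x y ∨ ((does (x ≟ u) ∧ does (y ≟ v)) ∨ (does (x ≟ v) ∧ does (y ≟ u)))

N : ∀ {n} → Adj n → Fin n → Subset n
N a x = tabulate (a x)

nbrs : ∀ {n} → Adj n → Fin n → List (Fin n)
nbrs a x = filter (λ z → a x z ≟ᵇ true) (allFin _)
  where
  open import Data.Bool.Properties using () renaming (_≟_ to _≟ᵇ_)

deg : ∀ {n} → Adj n → Fin n → ℕ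
deg a x = ∣ N a x ∣

B₁ : ∀ {n} → Adj n → Fin n → Subset n
B₁ a x = N a x ∪ ⁅ x ⁆

B₂ : ∀ {n} → Adj n → Fin n → Subset n
B₂ a x = tabulate λ z →
  any (λ w → Vec.lookup (B₁ a x) w ∧ Vec.lookup (B₁ a w) z) (allFin _)

ValidSeq : ∀ {n} → Adj n → List (Fin n × Fin n) → Set
ValidSeq a [] = ⊤
ValidSeq a ((u , v) ∷ S) =
  (¬ u ≡ v) × (a u v ≡ false) × ValidSeq (addEdge a u v) S

record State (n : ℕ) : Set where
  field
    adj : Adj n
    tB₁ tB₂ : Fin n → Subset n
    red black : Fin n → ℕ       -- δ_x and Δ_x
open State public

update : ∀ {n} {A : Set} → (Fin n → A) → Fin n → A → (Fin n → A)
update f x a z = if does (z ≟ x) then a else f z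

unionB₂ : ∀ {n} → Subset n → (Fin n → Subset n) → Fin n → (Fin n → Subset n)
unionB₂ S f w = update f w (f w ∪ S)

-- the i-th element of a list, index taken modulo its length
-- (this realises "a uniformly random neighbour": every outcome is
-- obtained for some index)
pick : ∀ {A : Set} → List A → ℕ → Maybe A
pick [] i = nothing
pick (a ∷ as) i = go (a ∷ as) (i % length (a ∷ as))
  where
  go : ∀ {A : Set} → List A → ℕ → Maybe A
  go [] _ = nothing
  go (b ∷ bs) zero = just b
  go (b ∷ bs) (suc j) = go bs j

picks : ∀ {A : Set} {k} → List A → Vec ℕ k → List A
picks xs Vec.[] = []
picks xs (i Vec.∷ is) with pick xs i
... | just w  = w ∷ picks xs is
... | nothing = picks xs is

-- Processing endpoint x with other endpoint y (edge already in adj).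
-- `rs` encodes the outcome of the k random choices.
-- Returns the new state and the number of set unions performed.
processVertex : ∀ {n k} → ℚ → State n → Fin n → Fin n → Vec ℕ k → State n × ℕ
processVertex {n} φ st x y rs =
  if does (φ ℚ.* ℕ→ℚ Δx ℚP.≤? ℕ→ℚ δ')
    then (record st { tB₁ = b₁ ; red = update (red st) x 0
                    ; black = update (black st) x (Δx ℕ.+ δ')
                    ; tB₂ = foldl (unionB₂ (b₁ x)) b₂ Nx }
         , 2 ℕ.+ length Nx)
    else (record st { tB₁ = b₁ ; red = update (red st) x δ'
                    ; tB₂ = foldl (unionB₂ (b₁ x)) b₂ ws }
         , 2 ℕ.+ length ws)
  where
  b₁ = update (tB₁ st) x (tB₁ st x ∪ ⁅ y ⁆)
  b₂ = update (tB₂ st) x (tB₂ st x ∪ b₁ y)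
  δ' = suc (red st x)
  Δx = black st x
  Nx = nbrs (adj st) x
  ws = picks Nx rs

processEdge : ∀ {n k} → ℚ → State n → Fin n × Fin n → Vec ℕ k → Vec ℕ k
            → State n × ℕ
processEdge φ st (u , v) ru rv =
  let st₀ = record st { adj = addEdge (adj st) u v }
      r₁  = processVertex φ st₀ u v ru
      r₂  = processVertex φ (proj₁ r₁) v u rv
  in proj₁ r₂ , proj₂ r₁ ℕ.+ proj₂ r₂

initState : ∀ {n} → Adj n → State n
initState a = record { adj = a ; tB₁ = B₁ a ; tB₂ = B₂ a
                     ; red = λ _ → 0 ; black = deg a }

runCost : ∀ {n k} → ℚ → State n → (ℕ → Vec ℕ k) → ℕ
        → List (Fin n × Fin n) → ℕ
runCost φ st rand t [] = 0
runCost φ st rand t (e ∷ S) =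
  let r = processEdge φ st e (rand (2 ℕ.* t)) (rand (suc (2 ℕ.* t)))
  in proj₂ r ℕ.+ runCost φ (proj₁ r) rand (suc t) S

T : ∀ {n} → ℚ → (k : ℕ) → Adj n → (ℕ → Vec ℕ k) → List (Fin n × Fin n) → ℕ
T φ k a rand S = runCost φ (initState a) rand 0 S

{-# OPTIONS --safe #-}
module Submission where

-- Write φ = p/q.  A triggered step at x performs 2 + deg x unions, and
-- deg x ≤ Δx + δx together with the trigger condition p·Δx ≤ q·δx bounds
-- p times this by 2p + (p+q)·δx; the step then resets δx.  A lazy step
-- performs at most 2 + k unions and raises δx by one.  Hence, with the
-- potential (p+q)·Σ δ, every endpoint step has amortised cost at most
-- p(3+k) + q, i.e. 3 + k + 1/φ after dividing by p.  The potential starts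
-- at 0, so T(S) ≤ 2(3 + k + 1/φ)|S| ≤ 8(1/φ + k)|S| when φ ≤ 1.

module LazyAlgAnalysis where

  open import Defs
  open import Data.Bool using (Bool; true; false; if_then_else_; _∨_; _∧_)
  open import Data.Bool.Properties using () renaming (_≟_ to _≟ᵇ_)
  open import Data.Nat using (ℕ; zero; suc; _+_; _*_; _≤_; z≤n; s≤s; NonZero)
  open import Data.Nat.Properties hiding (_≟_)
  open import Data.Nat.Tactic.RingSolver using (solve)
  open import Data.Nat.Coprimality using (1-coprimeTo)
  import Data.Nat.Coprimality as Coprime
  open import Data.Integer as ℤ using (+[1+_])
  import Data.Integer.Properties as ℤP
  open import Data.Rational as ℚ using (ℚ; mkℚ; _/_; 1ℚ; 1/_; Positive)
  import Data.Rational.Properties as ℚP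
  open import Data.Rational.Solver using (module +-*-Solver)
  open import Data.Rational.Unnormalised as ℚᵘ using (mkℚᵘ)
  import Data.Rational.Unnormalised.Properties as ℚᵘP
  open import Data.Fin using (Fin; zero; suc; _≟_)
  open import Data.Fin.Subset using (∣_∣)
  open import Data.List using (List; []; _∷_; length; filter)
  open import Data.Vec using (Vec; tabulate)
  open import Data.Maybe using (just; nothing)
  open import Data.Product using (_,_; proj₁; proj₂; ∃₂)
  open import Function using (_∘_; id)
  open import Relation.Nullary using (¬_; does; proof; yes; no; ofʸ; ofⁿ)
  open import Relation.Nullary.Decidable using (dec-true; dec-false)
  open import Relation.Binary.PropositionalEquality
  open import Algebra.Properties.Monoid.Sum +-0-monoid using (sum; sum-replicate-zero)

  𝟙[_≡_] : ∀ {n} → Fin n → Fin n → ℕ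
  𝟙[ z ≡ x ] = if does (z ≟ x) then 1 else 0

  ∣tabulate-false∣ : ∀ n → ∣ tabulate {n = n} (λ _ → false) ∣ ≡ 0
  ∣tabulate-false∣ zero    = refl
  ∣tabulate-false∣ (suc n) = ∣tabulate-false∣ n

  ∣tabulate-≟∣ : ∀ {n} (w : Fin n) → ∣ tabulate (λ y → does (y ≟ w)) ∣ ≡ 1
  ∣tabulate-≟∣ {suc n} zero    = cong suc (∣tabulate-false∣ n)
  ∣tabulate-≟∣ {suc n} (suc w) = ∣tabulate-≟∣ w

  ∣tabulate-∧-≟∣ : ∀ {n} c (w : Fin n) →
                   ∣ tabulate (λ y → c ∧ does (y ≟ w)) ∣ ≡ (if c then 1 else 0)
  ∣tabulate-∧-≟∣     true  w = ∣tabulate-≟∣ w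
  ∣tabulate-∧-≟∣ {n} false w = ∣tabulate-false∣ n

  ∣tabulate-∨∣≤ : ∀ {n} (f g : Fin n → Bool) →
                  ∣ tabulate (λ y → f y ∨ g y) ∣ ≤ ∣ tabulate f ∣ + ∣ tabulate g ∣
  ∣tabulate-∨∣≤ {zero}  f g = z≤n
  ∣tabulate-∨∣≤ {suc n} f g with f zero | g zero | ∣tabulate-∨∣≤ (f ∘ suc) (g ∘ suc)
  ... | true  | true  | ih = s≤s (≤-trans ih (+-monoʳ-≤ _ (n≤1+n _)))
  ... | true  | false | ih = s≤s ih
  ... | false | true  | ih = ≤-trans (s≤s ih) (≤-reflexive (sym (+-suc _ _)))
  ... | false | false | ih = ih

  length-filter-tabulate : ∀ {m n} (f : Fin m → Bool) (g : Fin n → Fin m) →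
    length (filter (λ y → f y ≟ᵇ true) (Data.List.tabulate g)) ≡ ∣ tabulate (f ∘ g) ∣
  length-filter-tabulate {n = zero}  f g = refl
  length-filter-tabulate {n = suc n} f g with f (g zero)
  ... | true  = cong suc (length-filter-tabulate f (g ∘ suc))
  ... | false = length-filter-tabulate f (g ∘ suc)

  length-nbrs : ∀ {n} (a : Adj n) x → length (nbrs a x) ≡ deg a x
  length-nbrs a x = length-filter-tabulate (a x) id

  deg-addEdge : ∀ {n} (a : Adj n) u v z →
                deg (addEdge a u v) z ≤ deg a z + (𝟙[ z ≡ u ] + 𝟙[ z ≡ v ])
  deg-addEdge a u v z = begin
    deg (addEdge a u v) z                          ≤⟨ ∣tabulate-∨∣≤ (a z) (λ y → uv y ∨ vu y) ⟩
    deg a z + ∣ tabulate (λ y → uv y ∨ vu y) ∣      ≤⟨ +-monoʳ-≤ (deg a z) (∣tabulate-∨∣≤ uv vu) ⟩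
    deg a z + (∣ tabulate uv ∣ + ∣ tabulate vu ∣)   ≡⟨ cong (deg a z +_) (cong₂ _+_ (∣tabulate-∧-≟∣ _ v) (∣tabulate-∧-≟∣ _ u)) ⟩
    deg a z + (𝟙[ z ≡ u ] + 𝟙[ z ≡ v ])            ∎
    where
    open ≤-Reasoning
    uv vu : Fin _ → Bool
    uv y = does (z ≟ u) ∧ does (y ≟ v)
    vu y = does (z ≟ v) ∧ does (y ≟ u)

  𝟙-refl : ∀ {n} (x : Fin n) → 𝟙[ x ≡ x ] ≡ 1
  𝟙-refl x = cong (if_then 1 else 0) (dec-true (x ≟ x) refl)

  𝟙-≢ : ∀ {n} {z x : Fin n} → ¬ z ≡ x → 𝟙[ z ≡ x ] ≡ 0
  𝟙-≢ {z = z} {x} z≢x = cong (if_then 1 else 0) (dec-false (z ≟ x) z≢x)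

  sum-update : ∀ {n} (f : Fin n → ℕ) x m → sum (update f x m) + f x ≡ sum f + m
  sum-update {suc n} f zero m = begin
    m + sum (f ∘ suc) + f zero   ≡⟨ +-comm (m + sum (f ∘ suc)) (f zero) ⟩
    f zero + (m + sum (f ∘ suc)) ≡⟨ cong (f zero +_) (+-comm m _) ⟩
    f zero + (sum (f ∘ suc) + m) ≡⟨ +-assoc (f zero) _ m ⟨
    f zero + sum (f ∘ suc) + m   ∎
    where open ≡-Reasoning
  sum-update {suc n} f (suc x) m = begin
    f zero + sum (update (f ∘ suc) x m) + f (suc x)   ≡⟨ +-assoc (f zero) _ _ ⟩
    f zero + (sum (update (f ∘ suc) x m) + f (suc x)) ≡⟨ cong (f zero +_) (sum-update (f ∘ suc) x m) ⟩
    f zero + (sum (f ∘ suc) + m)                      ≡⟨ +-assoc (f zero) _ m ⟨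
    f zero + sum (f ∘ suc) + m                        ∎
    where open ≡-Reasoning

  length-picks : ∀ {A : Set} {k} (xs : List A) (rs : Vec ℕ k) → length (picks xs rs) ≤ k
  length-picks xs Data.Vec.[] = z≤n
  length-picks xs (i Data.Vec.∷ rs) with pick xs i
  ... | just _  = s≤s (length-picks xs rs)
  ... | nothing = m≤n⇒m≤1+n (length-picks xs rs)

  ℕ→ℚ≡mkℚ : ∀ m → ℕ→ℚ m ≡ mkℚ (ℤ.+ m) 0 (Coprime.sym (1-coprimeTo m))
  ℕ→ℚ≡mkℚ m = ℚP.normalize-coprime _

  ℕ→ℚ-+ : ∀ m n → ℕ→ℚ (m + n) ≡ ℕ→ℚ m ℚ.+ ℕ→ℚ n
  ℕ→ℚ-+ m n rewrite ℕ→ℚ≡mkℚ m | ℕ→ℚ≡mkℚ n =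
    cong (_/ 1) (sym (cong₂ ℤ._+_ (ℤP.*-identityʳ (ℤ.+ m)) (ℤP.*-identityʳ (ℤ.+ n))))

  ℕ→ℚ-* : ∀ m n → ℕ→ℚ (m * n) ≡ ℕ→ℚ m ℚ.* ℕ→ℚ n
  ℕ→ℚ-* m n rewrite ℕ→ℚ≡mkℚ m | ℕ→ℚ≡mkℚ n = cong (_/ 1) (ℤP.pos-* m n)

  ℕ→ℚ-mono-≤ : ∀ {m n} → m ≤ n → ℕ→ℚ m ℚ.≤ ℕ→ℚ n
  ℕ→ℚ-mono-≤ {m} {n} m≤n rewrite ℕ→ℚ≡mkℚ m | ℕ→ℚ≡mkℚ n =
    ℚ.*≤* (subst₂ ℤ._≤_ (sym (ℤP.*-identityʳ (ℤ.+ m))) (sym (ℤP.*-identityʳ (ℤ.+ n))) (ℤ.+≤+ m≤n))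

  ℕ→ℚ-cancel-≤ : ∀ {m n} → ℕ→ℚ m ℚ.≤ ℕ→ℚ n → m ≤ n
  ℕ→ℚ-cancel-≤ {m} {n} m≤n rewrite ℕ→ℚ≡mkℚ m | ℕ→ℚ≡mkℚ n with m≤n
  ... | ℚ.*≤* m*1≤n*1 =
    ℤP.drop‿+≤+ (subst₂ ℤ._≤_ (ℤP.*-identityʳ (ℤ.+ m)) (ℤP.*-identityʳ (ℤ.+ n)) m*1≤n*1)

  positive-ratio : ∀ φ .{{_ : Positive φ}} → ∃₂ λ a b → φ ℚ.* ℕ→ℚ (suc b) ≡ ℕ→ℚ (suc a)
  positive-ratio φ@(mkℚ +[1+ a ] b _) =
    a , b , ℚP.toℚᵘ-injective (ℚᵘP.≃-trans (ℚP.toℚᵘ-homo-* φ (ℕ→ℚ (suc b))) φ*q≃p)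
    where
    φ*q≃p : mkℚᵘ +[1+ a ] b ℚᵘ.* ℚ.toℚᵘ (ℕ→ℚ (suc b)) ℚᵘ.≃ ℚ.toℚᵘ (ℕ→ℚ (suc a))
    φ*q≃p rewrite ℕ→ℚ≡mkℚ (suc a) | ℕ→ℚ≡mkℚ (suc b) = ℚᵘ.*≡* (begin
      +[1+ a ] ℤ.* +[1+ b ] ℤ.* ℤ.+ 1 ≡⟨ ℤP.*-identityʳ _ ⟩
      +[1+ a ] ℤ.* +[1+ b ]           ≡⟨ cong (λ d → +[1+ a ] ℤ.* ℤ.+ suc d) (*-identityʳ b) ⟨
      +[1+ a ] ℤ.* ℤ.+ suc (b * 1)    ∎)
      where open ≡-Reasoning

  ℕ→ℚ-C[q+kp]L : ∀ C q k p L →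
    ℕ→ℚ (C * (q + k * p) * L) ≡ ℕ→ℚ C ℚ.* (ℕ→ℚ q ℚ.+ ℕ→ℚ k ℚ.* ℕ→ℚ p) ℚ.* ℕ→ℚ L
  ℕ→ℚ-C[q+kp]L C q k p L = begin
    ℕ→ℚ (C * (q + k * p) * L)                              ≡⟨ ℕ→ℚ-* (C * (q + k * p)) L ⟩
    ℕ→ℚ (C * (q + k * p)) ℚ.* ℕ→ℚ L                        ≡⟨ cong (ℚ._* ℕ→ℚ L) (ℕ→ℚ-* C _) ⟩
    ℕ→ℚ C ℚ.* ℕ→ℚ (q + k * p) ℚ.* ℕ→ℚ L                    ≡⟨ cong (λ r → ℕ→ℚ C ℚ.* r ℚ.* ℕ→ℚ L) (ℕ→ℚ-+ q (k * p)) ⟩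
    ℕ→ℚ C ℚ.* (ℕ→ℚ q ℚ.+ ℕ→ℚ (k * p)) ℚ.* ℕ→ℚ L            ≡⟨ cong (λ r → ℕ→ℚ C ℚ.* (ℕ→ℚ q ℚ.+ r) ℚ.* ℕ→ℚ L) (ℕ→ℚ-* k p) ⟩
    ℕ→ℚ C ℚ.* (ℕ→ℚ q ℚ.+ ℕ→ℚ k ℚ.* ℕ→ℚ p) ℚ.* ℕ→ℚ L      ∎
    where open ≡-Reasoning

  module _ (φ : ℚ) (p q : ℕ) (φq≡p : φ ℚ.* ℕ→ℚ q ≡ ℕ→ℚ p) where

    ratio-≤⇒*-≤ : ∀ {m n} → φ ℚ.* ℕ→ℚ m ℚ.≤ ℕ→ℚ n → p * m ≤ q * n
    ratio-≤⇒*-≤ {m} {n} φm≤n = ℕ→ℚ-cancel-≤ (begin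
      ℕ→ℚ (p * m)                 ≡⟨ ℕ→ℚ-* p m ⟩
      ℕ→ℚ p ℚ.* ℕ→ℚ m             ≡⟨ cong (ℚ._* ℕ→ℚ m) φq≡p ⟨
      φ ℚ.* ℕ→ℚ q ℚ.* ℕ→ℚ m       ≡⟨ cong (ℚ._* ℕ→ℚ m) (ℚP.*-comm φ (ℕ→ℚ q)) ⟩
      ℕ→ℚ q ℚ.* φ ℚ.* ℕ→ℚ m       ≡⟨ ℚP.*-assoc (ℕ→ℚ q) φ (ℕ→ℚ m) ⟩
      ℕ→ℚ q ℚ.* (φ ℚ.* ℕ→ℚ m)     ≤⟨ ℚP.*-monoˡ-≤-nonNeg (ℕ→ℚ q) {{ℚP.normalize-nonNeg q 1}} φm≤n ⟩
      ℕ→ℚ q ℚ.* ℕ→ℚ n             ≡⟨ ℕ→ℚ-* q n ⟨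
      ℕ→ℚ (q * n)                 ∎)
      where open ℚP.≤-Reasoning

    1/φ*p≡q : .{{_ : ℚ.NonZero φ}} → 1/ φ ℚ.* ℕ→ℚ p ≡ ℕ→ℚ q
    1/φ*p≡q = begin
      1/ φ ℚ.* ℕ→ℚ p               ≡⟨ cong (1/ φ ℚ.*_) φq≡p ⟨
      1/ φ ℚ.* (φ ℚ.* ℕ→ℚ q)       ≡⟨ ℚP.*-assoc (1/ φ) φ (ℕ→ℚ q) ⟨
      1/ φ ℚ.* φ ℚ.* ℕ→ℚ q         ≡⟨ cong (ℚ._* ℕ→ℚ q) (ℚP.*-inverseˡ φ) ⟩
      1ℚ ℚ.* ℕ→ℚ q                 ≡⟨ ℚP.*-identityˡ (ℕ→ℚ q) ⟩
      ℕ→ℚ q                        ∎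
      where open ≡-Reasoning

    p*m≤C[q+kp]L⇒m≤C[1/φ+k]L : .{{_ : NonZero p}} .{{_ : ℚ.NonZero φ}} → ∀ {m} C k L →
      p * m ≤ C * (q + k * p) * L → ℕ→ℚ m ℚ.≤ ℕ→ℚ C ℚ.* (1/ φ ℚ.+ ℕ→ℚ k) ℚ.* ℕ→ℚ L
    p*m≤C[q+kp]L⇒m≤C[1/φ+k]L {m} C k L pm≤ = ℚP.*-cancelˡ-≤-pos (ℕ→ℚ p) {{ℚP.normalize-pos p 1}} (begin
      ℕ→ℚ p ℚ.* ℕ→ℚ m                                  ≡⟨ ℕ→ℚ-* p m ⟨
      ℕ→ℚ (p * m)                                      ≤⟨ ℕ→ℚ-mono-≤ pm≤ ⟩
      ℕ→ℚ (C * (q + k * p) * L)                        ≡⟨ ℕ→ℚ-C[q+kp]L C q k p L ⟩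
      C′ ℚ.* (ℕ→ℚ q ℚ.+ k′ ℚ.* p′) ℚ.* L′              ≡⟨ cong (λ r → C′ ℚ.* (r ℚ.+ k′ ℚ.* p′) ℚ.* L′) 1/φ*p≡q ⟨
      C′ ℚ.* (1/ φ ℚ.* p′ ℚ.+ k′ ℚ.* p′) ℚ.* L′        ≡⟨ +-*-Solver.solve 5
        (λ c r k l p → c :* (r :* p :+ k :* p) :* l := p :* (c :* (r :+ k) :* l)) refl C′ (1/ φ) k′ L′ p′ ⟩
      p′ ℚ.* (C′ ℚ.* (1/ φ ℚ.+ k′) ℚ.* L′)             ∎)
      where
      open ℚP.≤-Reasoning
      open +-*-Solver using (_:*_; _:+_; _:=_)
      C′ = ℕ→ℚ C
      k′ = ℕ→ℚ k
      L′ = ℕ→ℚ L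
      p′ = ℕ→ℚ p

  amortised-+ : ∀ p {c₁ c₂ b₁ b₂ Φ₀ Φ₁ Φ₂} →
                p * c₁ + Φ₁ ≤ b₁ + Φ₀ → p * c₂ + Φ₂ ≤ b₂ + Φ₁ →
                p * (c₁ + c₂) + Φ₂ ≤ (b₁ + b₂) + Φ₀
  amortised-+ p {c₁} {c₂} {b₁} {b₂} {Φ₀} {Φ₁} {Φ₂} first second = begin
    p * (c₁ + c₂) + Φ₂       ≡⟨ solve (p ∷ c₁ ∷ c₂ ∷ Φ₂ ∷ []) ⟩
    p * c₁ + (p * c₂ + Φ₂)   ≤⟨ +-monoʳ-≤ (p * c₁) second ⟩
    p * c₁ + (b₂ + Φ₁)       ≡⟨ solve (p ∷ c₁ ∷ b₂ ∷ Φ₁ ∷ []) ⟩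
    b₂ + (p * c₁ + Φ₁)       ≤⟨ +-monoʳ-≤ b₂ first ⟩
    b₂ + (b₁ + Φ₀)           ≡⟨ solve (b₁ ∷ b₂ ∷ Φ₀ ∷ []) ⟩
    (b₁ + b₂) + Φ₀           ∎
    where open ≤-Reasoning

  counters : ∀ {n} → State n → Fin n → ℕ
  counters st z = black st z + red st z

  -- The paper's invariant is deg = Δ + δ; slack z counts the insertions at z
  -- that are already in the graph but not yet in z's counters.
  DegreeCovered : ∀ {n} → State n → (Fin n → ℕ) → Set
  DegreeCovered st slack = ∀ z → deg (adj st) z ≤ slack z + counters st z

  processVertex-adj : ∀ {n k} φ (st : State n) x y (rs : Vec ℕ k) →
                      adj (proj₁ (processVertex φ st x y rs)) ≡ adj st
  processVertex-adj φ st x y rs with does (φ ℚ.* ℕ→ℚ (black st x) ℚP.≤? ℕ→ℚ (suc (red st x)))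
  ... | true  = refl
  ... | false = refl

  update-transfer : ∀ {n} (f g : Fin n → ℕ) x z →
    update f x (f x + suc (g x)) z + update g x 0 z ≡ 𝟙[ z ≡ x ] + (f z + g z)
  update-transfer f g x z with z ≟ x
  ... | yes refl = trans (+-identityʳ _) (+-suc _ _)
  ... | no _     = refl

  update-suc : ∀ {n} (f g : Fin n → ℕ) x z →
    f z + update g x (suc (g x)) z ≡ 𝟙[ z ≡ x ] + (f z + g z)
  update-suc f g x z with z ≟ x
  ... | yes refl = +-suc _ _
  ... | no _     = refl

  processVertex-counters : ∀ {n k} φ (st : State n) x y (rs : Vec ℕ k) z →
    counters (proj₁ (processVertex φ st x y rs)) z ≡ 𝟙[ z ≡ x ] + counters st z
  processVertex-counters φ st x y rs z
    with does (φ ℚ.* ℕ→ℚ (black st x) ℚP.≤? ℕ→ℚ (suc (red st x)))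
  ... | true  = update-transfer (black st) (red st) x z
  ... | false = update-suc (black st) (red st) x z

  processVertex-covered : ∀ {n k} φ (st : State n) x y (rs : Vec ℕ k) {slack} →
    DegreeCovered st (λ z → slack z + 𝟙[ z ≡ x ]) →
    DegreeCovered (proj₁ (processVertex φ st x y rs)) slack
  processVertex-covered φ st x y rs {slack} covered z
    rewrite processVertex-adj φ st x y rs | processVertex-counters φ st x y rs z =
    ≤-trans (covered z) (≤-reflexive (+-assoc (slack z) _ _))

  deg≤suc-counters : ∀ {n} (st : State n) x {slack : Fin n → ℕ} →
    DegreeCovered st (λ z → slack z + 𝟙[ z ≡ x ]) → slack x ≡ 0 →
    deg (adj st) x ≤ suc (counters st x)
  deg≤suc-counters st x covered slack≡0 with covered x
  ... | deg≤ rewrite slack≡0 | 𝟙-refl x = deg≤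

  addEdge-covered : ∀ {n} (st : State n) u v → DegreeCovered st (λ _ → 0) →
    DegreeCovered (record st { adj = addEdge (adj st) u v }) (λ z → 𝟙[ z ≡ v ] + 𝟙[ z ≡ u ])
  addEdge-covered st u v covered z = begin
    deg (addEdge (adj st) u v) z             ≤⟨ deg-addEdge (adj st) u v z ⟩
    deg (adj st) z + (𝟙[ z ≡ u ] + 𝟙[ z ≡ v ]) ≤⟨ +-monoˡ-≤ _ (covered z) ⟩
    counters st z + (𝟙[ z ≡ u ] + 𝟙[ z ≡ v ])  ≡⟨ +-comm (counters st z) _ ⟩
    𝟙[ z ≡ u ] + 𝟙[ z ≡ v ] + counters st z    ≡⟨ cong (_+ counters st z) (+-comm 𝟙[ z ≡ u ] _) ⟩
    𝟙[ z ≡ v ] + 𝟙[ z ≡ u ] + counters st z    ∎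
    where open ≤-Reasoning

  processEdge-adj : ∀ {n k} φ (st : State n) u v (ru rv : Vec ℕ k) →
                    adj (proj₁ (processEdge φ st (u , v) ru rv)) ≡ addEdge (adj st) u v
  processEdge-adj φ st u v ru rv =
    trans (processVertex-adj φ st₁ v u rv) (processVertex-adj φ st₀ u v ru)
    where
    st₀ = record st { adj = addEdge (adj st) u v }
    st₁ = proj₁ (processVertex φ st₀ u v ru)

  processEdge-covered : ∀ {n k} φ (st : State n) u v (ru rv : Vec ℕ k) →
    DegreeCovered st (λ _ → 0) → DegreeCovered (proj₁ (processEdge φ st (u , v) ru rv)) (λ _ → 0)
  processEdge-covered φ st u v ru rv covered =
    processVertex-covered φ st₁ v u rv {λ _ → 0}
      (processVertex-covered φ st₀ u v ru {λ z → 𝟙[ z ≡ v ]} (addEdge-covered st u v covered))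
    where
    st₀ = record st { adj = addEdge (adj st) u v }
    st₁ = proj₁ (processVertex φ st₀ u v ru)

  initState-covered : ∀ {n} (G₀ : Adj n) → DegreeCovered (initState G₀) (λ _ → 0)
  initState-covered G₀ z = ≤-reflexive (sym (+-identityʳ (deg G₀ z)))

  module Amortisation (φ : ℚ) (p q k : ℕ)
    (trigger⇒ : ∀ {Δ δ} → φ ℚ.* ℕ→ℚ Δ ℚ.≤ ℕ→ℚ δ → p * Δ ≤ q * δ) where

    Φ : ∀ {n} → State n → ℕ
    Φ st = (p + q) * sum (red st)

    vertexBudget : ℕ
    vertexBudget = p * (3 + k) + q

    edgeBudget : ℕ
    edgeBudget = vertexBudget + vertexBudget

    triggered-amortised : ∀ {L Δ δ S S′} → L ≤ suc (Δ + δ) → p * Δ ≤ q * suc δ →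
      S′ + δ ≡ S + 0 → p * (2 + L) + (p + q) * S′ ≤ vertexBudget + (p + q) * S
    triggered-amortised {L} {Δ} {δ} {S} {S′} L≤ pΔ≤qδ reset = begin
      p * (2 + L) + (p + q) * S′
        ≤⟨ +-monoˡ-≤ _ (*-monoʳ-≤ p (+-monoʳ-≤ 2 (≤-trans L≤ (≤-reflexive (sym (+-suc Δ δ)))))) ⟩
      p * (2 + (Δ + suc δ)) + (p + q) * S′
        ≡⟨ solve (p ∷ Δ ∷ δ ∷ q ∷ S′ ∷ []) ⟩
      2 * p + p * Δ + p * suc δ + (p + q) * S′
        ≤⟨ +-monoˡ-≤ _ (+-monoˡ-≤ _ (+-monoʳ-≤ (2 * p) pΔ≤qδ)) ⟩
      2 * p + q * suc δ + p * suc δ + (p + q) * S′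
        ≡⟨ solve (p ∷ q ∷ δ ∷ S′ ∷ []) ⟩
      p * 3 + q + (p + q) * (S′ + δ)
        ≡⟨ cong (λ s → p * 3 + q + (p + q) * s) (trans reset (+-identityʳ S)) ⟩
      p * 3 + q + (p + q) * S
        ≤⟨ +-monoˡ-≤ _ (+-monoˡ-≤ q (*-monoʳ-≤ p (m≤m+n 3 k))) ⟩
      vertexBudget + (p + q) * S ∎
      where open ≤-Reasoning

    lazy-amortised : ∀ {W δ S S′} → W ≤ k → S′ + δ ≡ S + suc δ →
      p * (2 + W) + (p + q) * S′ ≤ vertexBudget + (p + q) * S
    lazy-amortised {W} {δ} {S} {S′} W≤k raise = begin
      p * (2 + W) + (p + q) * S′     ≤⟨ +-monoˡ-≤ _ (*-monoʳ-≤ p (+-monoʳ-≤ 2 W≤k)) ⟩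
      p * (2 + k) + (p + q) * S′     ≡⟨ cong (λ s → p * (2 + k) + (p + q) * s) S′≡1+S ⟩
      p * (2 + k) + (p + q) * suc S  ≡⟨ solve (p ∷ q ∷ k ∷ S ∷ []) ⟩
      p * (3 + k) + q + (p + q) * S  ∎
      where
      open ≤-Reasoning
      S′≡1+S : S′ ≡ suc S
      S′≡1+S = +-cancelʳ-≡ δ S′ (suc S) (trans raise (+-suc S δ))

    processVertex-amortised : ∀ {n} (st : State n) x y (rs : Vec ℕ k) →
      deg (adj st) x ≤ suc (counters st x) →
      p * proj₂ (processVertex φ st x y rs) + Φ (proj₁ (processVertex φ st x y rs))
        ≤ vertexBudget + Φ st
    processVertex-amortised st x y rs deg≤
      with does (φ ℚ.* ℕ→ℚ (black st x) ℚP.≤? ℕ→ℚ (suc (red st x)))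
         | proof (φ ℚ.* ℕ→ℚ (black st x) ℚP.≤? ℕ→ℚ (suc (red st x)))
    ... | true  | ofʸ φΔ≤δ = triggered-amortised
            (≤-trans (≤-reflexive (length-nbrs (adj st) x)) deg≤) (trigger⇒ φΔ≤δ)
            (sum-update (red st) x 0)
    ... | false | ofⁿ _    = lazy-amortised (length-picks _ rs) (sum-update (red st) x _)

    processEdge-amortised : ∀ {n} (st : State n) u v (ru rv : Vec ℕ k) →
      DegreeCovered st (λ _ → 0) → ¬ u ≡ v →
      p * proj₂ (processEdge φ st (u , v) ru rv) + Φ (proj₁ (processEdge φ st (u , v) ru rv))
        ≤ edgeBudget + Φ st
    processEdge-amortised st u v ru rv covered u≢v =
      amortised-+ p {b₁ = vertexBudget} {b₂ = vertexBudget}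
        (processVertex-amortised st₀ u v ru (deg≤suc-counters st₀ u {λ z → 𝟙[ z ≡ v ]} covered₀ (𝟙-≢ u≢v)))
        (processVertex-amortised st₁ v u rv (deg≤suc-counters st₁ v covered₁ refl))
      where
      st₀ = record st { adj = addEdge (adj st) u v }
      st₁ = proj₁ (processVertex φ st₀ u v ru)
      covered₀ = addEdge-covered st u v covered
      covered₁ = processVertex-covered φ st₀ u v ru {λ z → 𝟙[ z ≡ v ]} covered₀

    runCost-amortised : ∀ {n} (rand : ℕ → Vec ℕ k) (st : State n) t S →
      DegreeCovered st (λ _ → 0) → ValidSeq (adj st) S →
      p * runCost φ st rand t S + 0 ≤ length S * edgeBudget + Φ st
    runCost-amortised rand st t [] _ _ =
      ≤-trans (≤-reflexive (trans (+-identityʳ _) (*-zeroʳ p))) z≤n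
    runCost-amortised rand st t ((u , v) ∷ S) covered (u≢v , _ , valid) =
      amortised-+ p {b₁ = edgeBudget} {b₂ = length S * edgeBudget}
        (processEdge-amortised st u v ru rv covered u≢v)
        (runCost-amortised rand (proj₁ (processEdge φ st (u , v) ru rv)) (suc t) S
          (processEdge-covered φ st u v ru rv covered)
          (subst (λ a → ValidSeq a S) (sym (processEdge-adj φ st u v ru rv)) valid))
      where
      ru = rand (2 * t)
      rv = rand (suc (2 * t))

    T-amortised : ∀ {n} (G₀ : Adj n) rand S → ValidSeq G₀ S →
                  p * T φ k G₀ rand S ≤ length S * edgeBudget
    T-amortised {n} G₀ rand S valid = begin
      p * T φ k G₀ rand S                       ≡⟨ +-identityʳ _ ⟨
      p * T φ k G₀ rand S + 0                   ≤⟨ runCost-amortised rand (initState G₀) 0 S (initState-covered G₀) valid ⟩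
      length S * edgeBudget + (p + q) * sum {n} (λ _ → 0)
        ≡⟨ cong (λ s → length S * edgeBudget + (p + q) * s) (sum-replicate-zero n) ⟩
      length S * edgeBudget + (p + q) * 0       ≡⟨ cong (length S * edgeBudget +_) (*-zeroʳ (p + q)) ⟩
      length S * edgeBudget + 0                 ≡⟨ +-identityʳ _ ⟩
      length S * edgeBudget                     ∎
      where open ≤-Reasoning

    edgeBudget≤8[q+kp] : p ≤ q → ∀ L → L * edgeBudget ≤ 8 * (q + k * p) * L
    edgeBudget≤8[q+kp] p≤q L = begin
      L * (p * (3 + k) + q + (p * (3 + k) + q))      ≡⟨ solve (L ∷ p ∷ q ∷ k ∷ []) ⟩
      (6 * p + 2 * q + 2 * (k * p)) * L              ≤⟨ *-monoˡ-≤ L (+-monoˡ-≤ _ (+-monoˡ-≤ _ (*-monoʳ-≤ 6 p≤q))) ⟩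
      (6 * q + 2 * q + 2 * (k * p)) * L              ≤⟨ m≤m+n _ (6 * (k * p) * L) ⟩
      (6 * q + 2 * q + 2 * (k * p)) * L + 6 * (k * p) * L ≡⟨ solve (L ∷ p ∷ q ∷ k ∷ []) ⟩
      8 * (q + k * p) * L                            ∎
      where open ≤-Reasoning

  T-bound : ∀ φ .{{_ : Positive φ}} → φ ℚ.≤ 1ℚ → ∀ k {n} (G₀ : Adj n) S →
    ValidSeq G₀ S → (rand : ℕ → Vec ℕ k) →
    ℕ→ℚ (T φ k G₀ rand S) ℚ.≤ ℕ→ℚ 8 ℚ.* ((1/ φ) {{ℚP.pos⇒nonZero φ}} ℚ.+ ℕ→ℚ k) ℚ.* ℕ→ℚ (length S)
  T-bound φ φ≤1 k G₀ S valid rand with positive-ratio φ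
  ... | a , b , φq≡p = p*m≤C[q+kp]L⇒m≤C[1/φ+k]L φ p q φq≡p 8 k (length S)
                         (≤-trans (T-amortised G₀ rand S valid) (edgeBudget≤8[q+kp] p≤q (length S)))
    where
    instance _ = ℚP.pos⇒nonZero φ
    p = suc a
    q = suc b
    open Amortisation φ p q k (ratio-≤⇒*-≤ φ p q φq≡p)
    p≤q : p ≤ q
    p≤q = subst₂ _≤_ (*-identityʳ p) (*-identityʳ q)
            (ratio-≤⇒*-≤ φ p q φq≡p (subst (ℚ._≤ 1ℚ) (sym (ℚP.*-identityʳ φ)) φ≤1))

open import Defs
open import Data.Nat using (ℕ; _<_)
open import Data.Fin using (Fin)
open import Data.Vec using (Vec)
open import Data.List using (List; length)
open import Data.Product using (_×_; ∃-syntax)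
open import Data.Rational using (ℚ; _≤_; _+_; _*_; 1ℚ; 1/_; Positive)
open import Data.Rational.Properties using (pos⇒nonZero)
open import Data.Nat using (s≤s; z≤n)
open import Data.Product using (_,_)
open LazyAlgAnalysis using (T-bound)

lemma2p1 : ∃[ C ] (0 < C) ×
  (∀ (φ : ℚ) .{{_ : Positive φ}} → φ ≤ 1ℚ → (k n : ℕ) → (G₀ : Adj n) →
    IsSimpleGraph G₀ → (S : List (Fin n × Fin n)) → ValidSeq G₀ S →
    (rand : ℕ → Vec ℕ k) →
    ℕ→ℚ (T φ k G₀ rand S)
      ≤ ℕ→ℚ C * ((1/ φ) {{pos⇒nonZero φ}} + ℕ→ℚ k) * ℕ→ℚ (length S))
lemma2p1 = 8 , s≤s z≤n , λ φ φ≤1 k n G₀ _ S valid rand → T-bound φ φ≤1 k G₀ S valid rand
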